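{- The set $\mathrm{Sort}(\mathfrak{s}_{\underline{12}3})=\bigcup_{n\ge1}\mathrm{Sort}_n(\mathfrak{s}_{\underline{12}3})$ is not a permutation class: $4132\in\mathrm{Sort}(\mathfrak{s}_{\underline{12}3})$ contains $132$, but $132\notin\mathrm{Sort}(\mathfrak{s}_{\underline{12}3})$.
   Context: A permutation class is a set of permutations closed under (classical) pattern containment. A pattern is a permutation $\sigma$ in which some blocks of consecutive entries may be underlined; a sequence contains it if it has a subsequence order-isomorphic to $\sigma$ whose entries corresponding to a common underlined block are adjacent in the sequence. Pattern-avoiding stack map $\mathfrak{s}_\sigma$: process input $\tau_1,\dots,\tau_n$ in order; when $\tau_i$ is next, while the stack is nonempty and the sequence formed by placing $\tau_i$ on top of the stack, read top to bottom, contains $\sigma$ (underlined entries adjacent in the stack), pop the top entry to the output; then push $\tau_i$; at the end pop all remaining entries top to bottom to the output. $\mathrm{Sort}_n(\mathfrak{s}_\sigma)$ is the set of $\tau\in\mathfrak S_n$ such that $\mathfrak{s}_\sigma(\tau)$ avoids $231$. -}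

module Defs where

open import Data.Nat using (ℕ; zero; suc; _≡ᵇ_; _<ᵇ_; _≤_)
open import Data.Bool using (Bool; true; false; _∧_; _∨_; not; if_then_else_; T)
open import Data.List using (List; []; _∷_; [_]; _++_; map; length; zip; upTo)
open import Data.Bool.ListAction using (all; any)
open import Data.Product using (_×_; _,_)
open import Data.List.Relation.Binary.Permutation.Propositional using (_↭_)

IsPerm : List ℕ → Set
IsPerm τ = τ ↭ map suc (upTo (length τ))

-- A (possibly underlined) pattern: the one-line notation of σ together with,
-- for each gap between consecutive entries j and j+1 of σ, a flag which is
-- true iff entries j and j+1 lie in a common underlined block (so must be
-- adjacent in the text).
record Pattern : Set where
  constructor pat
  field
    vals : List ℕ
    adj  : List Bool
open Pattern public

classical : List ℕ → Pattern
classical σ = pat σ []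

subseqs : {A : Set} → List A → List (List A)
subseqs []       = [] ∷ []
subseqs (x ∷ xs) = map (x ∷_) (subseqs xs) ++ subseqs xs

bEq : Bool → Bool → Bool
bEq true  b = b
bEq false b = not b

adjOK : List Bool → List (ℕ × ℕ) → Bool
adjOK (b ∷ bs) ((i , _) ∷ (j , v) ∷ rest) =
  (not b ∨ (j ≡ᵇ suc i)) ∧ adjOK bs ((j , v) ∷ rest)
adjOK _ _ = true

orderIso : List ℕ → List ℕ → Bool
orderIso σ w = (length σ ≡ᵇ length w) ∧
  all (λ p → all (λ q → bEq (Data.Product.proj₁ p <ᵇ Data.Product.proj₁ q)
                            (Data.Product.proj₂ p <ᵇ Data.Product.proj₂ q)) ps) ps
  where ps = zip σ w

contains : Pattern → List ℕ → Bool
contains p w = any (λ s → orderIso (vals p) (map Data.Product.proj₂ s) ∧ adjOK (adj p) s)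
                   (subseqs (zip (upTo (length w)) w))

avoids : Pattern → List ℕ → Bool
avoids p w = not (contains p w)

-- The stack is a list with its top first.
-- pops σ x stack out: while the stack is nonempty and (x placed on top of the
-- stack, read top to bottom) contains σ, pop the top to the output.
pops : Pattern → ℕ → List ℕ → List ℕ → List ℕ × List ℕ
pops σ x []       out = [] , out
pops σ x (s ∷ st) out =
  if contains σ (x ∷ s ∷ st) then pops σ x st (out ++ [ s ]) else (s ∷ st , out)

run : Pattern → List ℕ → List ℕ → List ℕ → List ℕ
run σ []       st out = out ++ st
run σ (x ∷ xs) st out with pops σ x st out
... | st' , out' = run σ xs (x ∷ st') out'

stackMap : Pattern → List ℕ → List ℕ
stackMap σ τ = run σ τ [] []

p12-3 : Pattern
p12-3 = pat (1 ∷ 2 ∷ 3 ∷ []) (true ∷ false ∷ [])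

InSort : Pattern → List ℕ → Set
InSort σ τ = IsPerm τ × (1 ≤ length τ) × T (avoids (classical (2 ∷ 3 ∷ 1 ∷ [])) (stackMap σ τ))

IsPermClass : (List ℕ → Set) → Set
IsPermClass C = (π σ : List ℕ) → C π → IsPerm σ → T (contains (classical σ) π) → C σ

{-# OPTIONS --safe #-}
module Submission where

open import Defs
open import Data.Bool using (T)
open import Data.List using (List; []; _∷_)
open import Data.Product using (_×_; _,_)
open import Data.Unit using (tt)
open import Data.Nat using (ℕ; s≤s; z≤n)
open import Data.List.Relation.Binary.Permutation.Propositional using (refl; prep; swap; trans)
open import Relation.Binary.PropositionalEquality using (_≡_; refl; subst; sym)
open import Relation.Nullary using (¬_)
open import Function using (_∘_)

¬IsPermClass : ∀ {C : List ℕ → Set} π σ → C π → IsPerm σ →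
               T (contains (classical σ) π) → ¬ C σ → ¬ IsPermClass C
¬IsPermClass π σ π∈C σ-perm σ⊆π σ∉C closed = σ∉C (closed π σ π∈C σ-perm σ⊆π)

4132-isPerm : IsPerm (4 ∷ 1 ∷ 3 ∷ 2 ∷ [])
4132-isPerm = trans (swap 4 1 refl) (prep 1 (trans (swap 4 3 refl)
               (trans (prep 3 (swap 4 2 refl)) (swap 3 2 refl))))

132-isPerm : IsPerm (1 ∷ 3 ∷ 2 ∷ [])
132-isPerm = prep 1 (swap 3 2 refl)

-- Only when 2 arrives is anything popped: 2 3 4 is a 12-3 occurrence, so 3 leaves the stack.
stackMap-4132 : stackMap p12-3 (4 ∷ 1 ∷ 3 ∷ 2 ∷ []) ≡ 3 ∷ 2 ∷ 1 ∷ 4 ∷ []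
stackMap-4132 = refl

-- Nothing is ever popped (no entry exceeds the 2 3 on top), so the output is the reversed input.
stackMap-132 : stackMap p12-3 (1 ∷ 3 ∷ 2 ∷ []) ≡ 2 ∷ 3 ∷ 1 ∷ []
stackMap-132 = refl

p231 : Pattern
p231 = classical (2 ∷ 3 ∷ 1 ∷ [])

4132∈Sort : InSort p12-3 (4 ∷ 1 ∷ 3 ∷ 2 ∷ [])
4132∈Sort = 4132-isPerm , s≤s z≤n , subst (T ∘ avoids p231) (sym stackMap-4132) tt

132∉Sort : ¬ InSort p12-3 (1 ∷ 3 ∷ 2 ∷ [])
132∉Sort (_ , _ , avoids231) = subst (T ∘ avoids p231) stackMap-132 avoids231

132⊆4132 : T (contains (classical (1 ∷ 3 ∷ 2 ∷ [])) (4 ∷ 1 ∷ 3 ∷ 2 ∷ []))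
132⊆4132 = tt

mainTheorem14 : ¬ IsPermClass (InSort p12-3)
    × InSort p12-3 (4 ∷ 1 ∷ 3 ∷ 2 ∷ [])
    × T (contains (classical (1 ∷ 3 ∷ 2 ∷ [])) (4 ∷ 1 ∷ 3 ∷ 2 ∷ []))
    × ¬ InSort p12-3 (1 ∷ 3 ∷ 2 ∷ [])
mainTheorem14 =
  ¬IsPermClass _ _ 4132∈Sort 132-isPerm 132⊆4132 132∉Sort , 4132∈Sort , 132⊆4132 , 132∉Sort
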